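{- If $r\rightleftarrows s$, then $M(r)=M(s)$.
   Context: Preterms are $r ::= x \mid \lambda x.r \mid rr \mid r\times r \mid \pi_A(r)$ (application left associative), where $A$ ranges over types generated by $A::=\tau\mid A\Rightarrow A\mid A\wedge A$ and variables are drawn from sets $\mathcal V_A$ indexed by types; one writes $\lambda x^A.r$ for $\lambda x.r$ when $x\in\mathcal V_A$. Terms are the well-typed preterms. The relation $\rightleftarrows$ is the smallest symmetric relation on terms, closed under all term contexts, containing: $r\times s\rightleftarrows s\times r$; $(r\times s)\times t\rightleftarrows r\times(s\times t)$; $\lambda x^A.(r\times s)\rightleftarrows \lambda x^A.r\times\lambda x^A.s$; $rst\rightleftarrows r(s\times t)$. The functions $P$ and $M$ on terms are defined by: $P(x)=0$, $P(\lambda x^A.r)=P(r)$, $P(rs)=0$, $P(r\times s)=1+P(r)+P(s)$, $P(\pi_A(r))=0$; $M(x)=1$, $M(\lambda x^A.r)=1+M(r)+P(r)$, $M(rs)=1+M(r)+M(s)$, $M(r\times s)=1+M(r)+M(s)$, $M(\pi_A(r))=1+M(r)$. -}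

module Defs where

open import Data.Nat using (ℕ; zero; suc; _+_)
open import Data.Product using (Σ; _×_; _,_)

infixr 30 _⇒_
infixr 35 _∧_
data Type : Set where
  τ   : Type
  _⇒_ : Type → Type → Type
  _∧_ : Type → Type → Type

-- Variables are drawn from sets V_A indexed by types: x = (A , n) ∈ V_A.
Var : Set
Var = Type × ℕ

data PreTerm : Set where
  var  : Var → PreTerm
  lam  : Var → PreTerm → PreTerm
  app  : PreTerm → PreTerm → PreTerm
  pair : PreTerm → PreTerm → PreTerm
  proj : Type → PreTerm → PreTerm

data _≡ᵀ_ : Type → Type → Set where
  comm   : ∀ {A B} → (A ∧ B) ≡ᵀ (B ∧ A)
  asso   : ∀ {A B C} → ((A ∧ B) ∧ C) ≡ᵀ (A ∧ (B ∧ C))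
  dist   : ∀ {A B C} → (A ⇒ (B ∧ C)) ≡ᵀ ((A ⇒ B) ∧ (A ⇒ C))
  curry  : ∀ {A B C} → ((A ∧ B) ⇒ C) ≡ᵀ (A ⇒ (B ⇒ C))
  refl   : ∀ {A} → A ≡ᵀ A
  sym    : ∀ {A B} → A ≡ᵀ B → B ≡ᵀ A
  trans  : ∀ {A B C} → A ≡ᵀ B → B ≡ᵀ C → A ≡ᵀ C
  ⇒-cong : ∀ {A A' B B'} → A ≡ᵀ A' → B ≡ᵀ B' → (A ⇒ B) ≡ᵀ (A' ⇒ B')
  ∧-cong : ∀ {A A' B B'} → A ≡ᵀ A' → B ≡ᵀ B' → (A ∧ B) ≡ᵀ (A' ∧ B')

-- Typing (variables carry their type, so no context is needed).
data _⦂_ : PreTerm → Type → Set where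
  ty-var  : ∀ {A n} → var (A , n) ⦂ A
  ty-lam  : ∀ {A n r B} → r ⦂ B → lam (A , n) r ⦂ (A ⇒ B)
  ty-app  : ∀ {r s A B} → r ⦂ (A ⇒ B) → s ⦂ A → app r s ⦂ B
  ty-pair : ∀ {r s A B} → r ⦂ A → s ⦂ B → pair r s ⦂ (A ∧ B)
  ty-proj : ∀ {r A B} → r ⦂ (A ∧ B) → proj A r ⦂ A
  ty-conv : ∀ {r A B} → r ⦂ A → A ≡ᵀ B → r ⦂ B

WellTyped : PreTerm → Set
WellTyped r = Σ Type (λ A → r ⦂ A)

infix 4 _⇄_
data _⇄_ : PreTerm → PreTerm → Set where
  comm  : ∀ {r s} → pair r s ⇄ pair s r
  asso  : ∀ {r s t} → pair (pair r s) t ⇄ pair r (pair s t)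
  dist  : ∀ {x r s} → lam x (pair r s) ⇄ pair (lam x r) (lam x s)
  curry : ∀ {r s t} → app (app r s) t ⇄ app r (pair s t)
  sym   : ∀ {r s} → r ⇄ s → s ⇄ r
  c-lam   : ∀ {x r r'} → r ⇄ r' → lam x r ⇄ lam x r'
  c-appˡ  : ∀ {r r' s} → r ⇄ r' → app r s ⇄ app r' s
  c-appʳ  : ∀ {r s s'} → s ⇄ s' → app r s ⇄ app r s'
  c-pairˡ : ∀ {r r' s} → r ⇄ r' → pair r s ⇄ pair r' s
  c-pairʳ : ∀ {r s s'} → s ⇄ s' → pair r s ⇄ pair r s'
  c-proj  : ∀ {A r r'} → r ⇄ r' → proj A r ⇄ proj A r'

P : PreTerm → ℕ
P (var x)    = 0
P (lam x r)  = P r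
P (app r s)  = 0
P (pair r s) = 1 + P r + P s
P (proj A r) = 0

M : PreTerm → ℕ
M (var x)    = 1
M (lam x r)  = 1 + M r + P r
M (app r s)  = 1 + M r + M s
M (pair r s) = 1 + M r + M s
M (proj A r) = 1 + M r

-- Each base equation rearranges the
-- summands of M (commutativity, associativity, currying), except distributivity
-- λx.(r × s) ⇄ λx.r × λx.s, which moves the contribution P of the pair out of
-- the abstraction; this is exactly compensated by the extra pair node.
module Submission where

open import Defs
open import Relation.Binary.PropositionalEquality as ≡ using (_≡_; refl; cong; cong₂)
open import Data.Nat using (ℕ; suc; _+_)
open import Data.Nat.Properties using (+-comm)
open import Data.Nat.Tactic.RingSolver using (solve-∀)

-- The shape of an associativity / currying step on a node counting 1:
-- (1 + a + b) + c = a + (1 + b + c).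
regroup : ∀ a b c → suc (a + b) + c ≡ a + suc (b + c)
regroup = solve-∀

-- The shape of a distributivity step: the two summands a, c (from one side)
-- and b, d (from the other) are exchanged between two nodes.
interchange : ∀ a b c d → suc (a + b) + suc (c + d) ≡ suc (a + c) + suc (b + d)
interchange = solve-∀

-- P (the number of pairs reachable through abstractions) is invariant under ⇄.
P-invariant : ∀ {r s} → r ⇄ s → P r ≡ P s
P-invariant (comm {r} {s})      = cong suc (+-comm (P r) (P s))
P-invariant (asso {r} {s} {t})  = cong suc (regroup (P r) (P s) (P t))
P-invariant dist                = refl
P-invariant curry               = refl
P-invariant (sym e)             = ≡.sym (P-invariant e)
P-invariant (c-lam e)           = P-invariant e
P-invariant (c-appˡ e)          = refl
P-invariant (c-appʳ e)          = refl
P-invariant (c-pairˡ {s = s} e) = cong (λ p → suc (p + P s)) (P-invariant e)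
P-invariant (c-pairʳ {r = r} e) = cong (λ p → suc (P r + p)) (P-invariant e)
P-invariant (c-proj e)          = refl

M-invariant : ∀ {r s} → r ⇄ s → M r ≡ M s
M-invariant (comm {r} {s})      = cong suc (+-comm (M r) (M s))
M-invariant (asso {r} {s} {t})  = cong suc (regroup (M r) (M s) (M t))
M-invariant (dist {r = r} {s})  = cong suc (interchange (M r) (M s) (P r) (P s))
M-invariant (curry {r} {s} {t}) = cong suc (regroup (M r) (M s) (M t))
M-invariant (sym e)             = ≡.sym (M-invariant e)
M-invariant (c-lam e)           = cong suc (cong₂ _+_ (M-invariant e) (P-invariant e))
M-invariant (c-appˡ {s = s} e)  = cong (λ m → suc (m + M s)) (M-invariant e)
M-invariant (c-appʳ {r = r} e)  = cong (λ m → suc (M r + m)) (M-invariant e)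
M-invariant (c-pairˡ {s = s} e) = cong (λ m → suc (m + M s)) (M-invariant e)
M-invariant (c-pairʳ {r = r} e) = cong (λ m → suc (M r + m)) (M-invariant e)
M-invariant (c-proj e)          = cong suc (M-invariant e)

mainTheorem16 : ∀ (r s : PreTerm) → WellTyped r → WellTyped s → r ⇄ s → M r ≡ M s
mainTheorem16 r s _ _ r⇄s = M-invariant r⇄s
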